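{- In a simple $n$-uniform hypergraph with maximum vertex degree $d$, any vertex belongs to at most $k\,d\,(k-1)\,(nd)^{k-2}\,n^2$ almost disjoint cycles of length $k$, for every $k\ge 3$.
   Context: A hypergraph has a finite vertex set and a family of subsets called edges; it is $n$-uniform if every edge has $n$ elements and simple if any two distinct edges share at most one vertex. A chain is a sequence of edges $(s_1,\ldots,s_k)$ with $|s_i\cap s_{i+1}|=1$ for $i\in[k-1]$ and the sets $s_i\cap s_{i+1}$ pairwise disjoint. A chain is disjoint if $s_i\cap s_j=\emptyset$ whenever $|i-j|>1$. A chain $(s_1,\ldots,s_k)$ is an almost disjoint cycle if $s_1\cap s_k\ne\emptyset$ and both $(s_1,\ldots,s_{k-1})$ and $(s_2,\ldots,s_k)$ are disjoint chains. A vertex belongs to a chain if it lies in one of its edges; cycles are counted as sequences. -}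

module Defs where

open import Data.Nat using (ℕ; zero; suc; _+_; _*_; _∸_; _^_; _≤_; _<_)
open import Data.Fin using (Fin; toℕ; fromℕ; inject₁) renaming (zero to fzero; suc to fsuc)
open import Data.Fin.Subset using (Subset; _∈_; _∩_; ∣_∣; Empty; Nonempty)
open import Data.Fin.Subset.Properties using (_∈?_)
open import Data.List using (List; length; filter; allFin)
open import Data.Vec using (Vec; lookup)
open import Data.Product using (_×_; ∃; Σ)
open import Data.Empty using (⊥)
open import Function using (_∘_)
open import Function.Definitions using (Injective)
open import Relation.Binary.PropositionalEquality using (_≡_; _≢_)

-- A hypergraph on vertex set Fin V with m edges, given by E : Fin m → Subset V
-- (E injective, so the edges form a set).

degree : ∀ {V m} → (Fin m → Subset V) → Fin V → ℕ
degree {m = m} E u = length (filter (λ i → u ∈? E i) (allFin m))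

MaxDegree : ∀ {V m} → (Fin m → Subset V) → ℕ → Set
MaxDegree E d = (∀ u → degree E u ≤ d) × ∃ (λ u → degree E u ≡ d)

Uniform : ∀ {V m} → ℕ → (Fin m → Subset V) → Set
Uniform n E = ∀ i → ∣ E i ∣ ≡ n

Simple : ∀ {V m} → (Fin m → Subset V) → Set
Simple E = ∀ i j → i ≢ j → ∣ E i ∩ E j ∣ ≤ 1

IsChain : ∀ {V k} → (Fin k → Subset V) → Set
IsChain s =
  (∀ i j → toℕ j ≡ suc (toℕ i) → ∣ s i ∩ s j ∣ ≡ 1) ×
  (∀ i j i' j' → toℕ j ≡ suc (toℕ i) → toℕ j' ≡ suc (toℕ i') → toℕ i ≢ toℕ i' →
     Empty ((s i ∩ s j) ∩ (s i' ∩ s j')))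

IsDisjointChain : ∀ {V k} → (Fin k → Subset V) → Set
IsDisjointChain s = IsChain s ×
  (∀ i j → suc (toℕ i) < toℕ j → Empty (s i ∩ s j)) ×
  (∀ i j → suc (toℕ j) < toℕ i → Empty (s i ∩ s j))

IsAlmostDisjointCycle : ∀ {V} (k : ℕ) → (Fin k → Subset V) → Set
IsAlmostDisjointCycle zero s = ⊥
IsAlmostDisjointCycle (suc k) s =
  IsChain s × Nonempty (s fzero ∩ s (fromℕ k)) ×
  IsDisjointChain (s ∘ inject₁) × IsDisjointChain (s ∘ fsuc)

AlmostDisjointCycle : ∀ {V m} → (Fin m → Subset V) → (k : ℕ) → Vec (Fin m) k → Set
AlmostDisjointCycle E k c = IsAlmostDisjointCycle k (λ i → E (lookup c i))

BelongsTo : ∀ {V m k} → (Fin m → Subset V) → Fin V → Vec (Fin m) k → Set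
BelongsTo E v c = ∃ λ i → v ∈ E (lookup c i)

-- Rotate an almost disjoint k-cycle through v so that its first edge e₀ contains v: at most
-- k offsets and d choices of e₀. Each of the next k - 2 edges meets its predecessor, so it is
-- one of the at most n·d edges through a vertex of the predecessor. The last edge meets both
-- its predecessor and e₀, in vertices a and b. These differ, because no vertex of an almost
-- disjoint cycle lies in three cyclically consecutive edges, so by simplicity the last edge
-- is the unique edge through a and b: at most n² choices. This gives k·d·(nd)^(k-2)·n²
-- cycles, below the claimed bound by the factor k - 1.

module Submission where

open import Defs
open import Data.Empty using (⊥)
open import Data.Vec as Vec using (Vec; lookup; tabulate)
open import Data.Fin using (Fin; toℕ; fromℕ; inject₁; _≟_) renaming (zero to fzero; suc to fsuc)
open import Data.Fin.Properties using (toℕ-injective; toℕ-fromℕ<; toℕ-fromℕ; toℕ-inject₁; toℕ<n)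
open import Data.Fin.Subset using (Subset; inside; outside; _∩_; ∣_∣; Nonempty; ⁅_⁆; _⊆_)
  renaming (_∈_ to _∈ₛ_)
open import Data.Fin.Subset.Properties
  using (_∈?_; x∈p∩q⁺; x∈p∩q⁻; ∩-comm; nonempty?; Empty-unique; ∣⊥∣≡0; p⊂q⇒∣p∣<∣q∣; x∈⁅y⁆⇒x≡y; ∣⁅x⁆∣≡1)
open import Data.List using (List; []; _∷_; length; map; _++_; concatMap; filter; allFin; take; upTo)
open import Data.List.Properties using (length-++; length-++-sucʳ; length-map; length-upTo)
open import Data.List.Membership.Propositional using (_∈_; lose)
open import Data.List.Membership.Propositional.Properties
  using (∈-∃++; ∈-concatMap⁺; ∈-map⁺; ∈-filter⁺; ∈-filter⁻; ∈-allFin; ∈-upTo⁺)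
open import Data.List.Relation.Unary.Any using (here; there)
open import Data.List.Relation.Unary.All as All using (All; []; _∷_)
open import Data.List.Relation.Unary.AllPairs using ([]; _∷_)
open import Data.List.Relation.Unary.Unique.Propositional using (Unique)
open import Data.Nat using (ℕ; zero; suc; _+_; _*_; _∸_; _^_; _≤_; _<_; z≤n; s≤s; NonZero)
open import Data.Nat.Properties
  using (≤-reflexive; ≤-trans; <-trans; <⇒≤; <⇒≱; n<1+n; 1+n≢n; m≤n⇒m<n∨m≡n; +-mono-≤; +-assoc; +-comm;
         m∸n+n≡m; *-identityˡ; *-assoc; m≤m*n; module ≤-Reasoning)
open import Data.Nat.Solver using (module +-*-Solver)
open import Data.Nat.DivMod using (_%_; _mod_; %-distribˡ-+; m%n%n≡m%n; [m+n]%n≡m%n; m<n⇒m%n≡m; m%n<n)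
open import Data.Vec.Properties using (lookup∘tabulate; tabulate∘lookup; tabulate-cong)
open import Data.Product using (_×_; _,_; ∃₂; proj₂)
open import Data.Sum using (inj₁; inj₂)
open import Function using (_∘_)
open import Function.Definitions using (Injective)
open import Relation.Nullary using (yes; no; contradiction)
open import Relation.Nullary.Decidable using (_×-dec_)
open import Relation.Unary using (Decidable)
open import Relation.Binary.PropositionalEquality
  using (_≡_; _≢_; refl; sym; trans; cong; subst; subst₂; module ≡-Reasoning)

private variable
  A B : Set

∈-++-∷⁻ : ∀ {x y : A} xs {ys} → y ∈ xs ++ x ∷ ys → y ≢ x → y ∈ xs ++ ys
∈-++-∷⁻ []       (here refl) y≢x = contradiction refl y≢x
∈-++-∷⁻ []       (there y∈)  y≢x = y∈
∈-++-∷⁻ (_ ∷ xs) (here refl) y≢x = here refl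
∈-++-∷⁻ (_ ∷ xs) (there y∈)  y≢x = there (∈-++-∷⁻ xs y∈ y≢x)

unique⊆⇒length≤ : ∀ {xs ys : List A} → Unique xs → All (_∈ ys) xs → length xs ≤ length ys
unique⊆⇒length≤ [] [] = z≤n
unique⊆⇒length≤ {xs = x ∷ xs} (x≢xs ∷ unique) (x∈ys ∷ xs⊆ys) with ∈-∃++ x∈ys
... | ys₁ , ys₂ , refl = begin
  suc (length xs)           ≤⟨ s≤s (unique⊆⇒length≤ unique xs⊆ys₁++ys₂) ⟩
  suc (length (ys₁ ++ ys₂)) ≡⟨ length-++-sucʳ ys₁ x ys₂ ⟨
  length (ys₁ ++ x ∷ ys₂)   ∎
  where
  open ≤-Reasoning
  xs⊆ys₁++ys₂ : All (_∈ ys₁ ++ ys₂) xs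
  xs⊆ys₁++ys₂ = All.zipWith (λ (x≢y , y∈) → ∈-++-∷⁻ ys₁ y∈ (x≢y ∘ sym)) (x≢xs , xs⊆ys)

∈-concatMap : ∀ (f : A → List B) {x xs y} → x ∈ xs → y ∈ f x → y ∈ concatMap f xs
∈-concatMap f x∈xs y∈fx = ∈-concatMap⁺ f (lose x∈xs y∈fx)

length-concatMap≤ : ∀ (f : A → List B) xs {a b} → length xs ≤ a → (∀ x → length (f x) ≤ b) →
                    length (concatMap f xs) ≤ a * b
length-concatMap≤ f []       _           _ = z≤n
length-concatMap≤ f (x ∷ xs) {suc a} {b} (s≤s ∣xs∣≤a) ∣f∣≤b = begin
  length (f x ++ concatMap f xs)          ≡⟨ length-++ (f x) ⟩
  length (f x) + length (concatMap f xs)  ≤⟨ +-mono-≤ (∣f∣≤b x) (length-concatMap≤ f xs ∣xs∣≤a ∣f∣≤b) ⟩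
  b + a * b                               ∎
  where open ≤-Reasoning

length-take-1 : ∀ (xs : List A) → length (take 1 xs) ≤ 1
length-take-1 []      = z≤n
length-take-1 (_ ∷ _) = s≤s z≤n

∈-take-1 : ∀ {x : A} {xs} → x ∈ xs → (∀ {y} → y ∈ xs → y ≡ x) → x ∈ take 1 xs
∈-take-1 {xs = y ∷ _} _ only-x = here (sym (only-x (here refl)))

prepend : ∀ {n} → (A → List (Vec A n)) → A → List (Vec A (suc n))
prepend h x = map (x Vec.∷_) (h x)

length-prepend : ∀ {n b} (h : A → List (Vec A n)) → (∀ x → length (h x) ≤ b) → ∀ x → length (prepend h x) ≤ b
length-prepend h ∣h∣≤b x = ≤-trans (≤-reflexive (length-map (x Vec.∷_) (h x))) (∣h∣≤b x)

∈-prepend : ∀ {n} (h : A → List (Vec A n)) {x w} → w ∈ h x → x Vec.∷ w ∈ prepend h x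
∈-prepend h {x} = ∈-map⁺ (x Vec.∷_)

elements : ∀ {n} → Subset n → List (Fin n)
elements Vec.[]             = []
elements (inside  Vec.∷ p) = fzero ∷ map fsuc (elements p)
elements (outside Vec.∷ p) = map fsuc (elements p)

length-elements : ∀ {n} (p : Subset n) → length (elements p) ≡ ∣ p ∣
length-elements Vec.[]             = refl
length-elements (inside  Vec.∷ p) = cong suc (trans (length-map fsuc (elements p)) (length-elements p))
length-elements (outside Vec.∷ p) = trans (length-map fsuc (elements p)) (length-elements p)

∈-elements : ∀ {n} {x : Fin n} {p} → x ∈ₛ p → x ∈ elements p
∈-elements {p = inside  Vec.∷ _} Vec.here        = here refl
∈-elements {p = inside  Vec.∷ _} (Vec.there x∈p) = there (∈-map⁺ fsuc (∈-elements x∈p))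
∈-elements {p = outside Vec.∷ _} (Vec.there x∈p) = ∈-map⁺ fsuc (∈-elements x∈p)

∣p∣≡1⇒Nonempty : ∀ {n} (p : Subset n) → ∣ p ∣ ≡ 1 → Nonempty p
∣p∣≡1⇒Nonempty {n} p ∣p∣≡1 with nonempty? p
... | yes p≢∅ = p≢∅
... | no  p≡∅ = contradiction (trans (sym ∣p∣≡1) (trans (cong ∣_∣ (Empty-unique p≡∅)) (∣⊥∣≡0 n))) λ ()

x≢y⇒1<∣p∣ : ∀ {n} {x y : Fin n} {p} → x ∈ₛ p → y ∈ₛ p → x ≢ y → 1 < ∣ p ∣
x≢y⇒1<∣p∣ {x = x} {y} {p} x∈p y∈p x≢y =
  subst (_< ∣ p ∣) (∣⁅x⁆∣≡1 x) (p⊂q⇒∣p∣<∣q∣ (⁅x⁆⊆p , y , y∈p , x≢y ∘ sym ∘ x∈⁅y⁆⇒x≡y x))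
  where
  ⁅x⁆⊆p : ⁅ x ⁆ ⊆ p
  ⁅x⁆⊆p z∈⁅x⁆ = subst (_∈ₛ p) (sym (x∈⁅y⁆⇒x≡y x z∈⁅x⁆)) x∈p

[m+n%d]%d≡[m+n]%d : ∀ m n d .{{_ : NonZero d}} → (m + n % d) % d ≡ (m + n) % d
[m+n%d]%d≡[m+n]%d m n d = begin
  (m + n % d) % d          ≡⟨ %-distribˡ-+ m (n % d) d ⟩
  (m % d + n % d % d) % d  ≡⟨ cong (λ r → (m % d + r) % d) (m%n%n≡m%n n d) ⟩
  (m % d + n % d) % d      ≡⟨ %-distribˡ-+ m n d ⟨
  (m + n) % d              ∎
  where open ≡-Reasoning

[m%d+n]%d≡[m+n]%d : ∀ m n d .{{_ : NonZero d}} → (m % d + n) % d ≡ (m + n) % d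
[m%d+n]%d≡[m+n]%d m n d = begin
  (m % d + n) % d  ≡⟨ cong (_% d) (+-comm (m % d) n) ⟩
  (n + m % d) % d  ≡⟨ [m+n%d]%d≡[m+n]%d n m d ⟩
  (n + m) % d      ≡⟨ cong (_% d) (+-comm n m) ⟩
  (m + n) % d      ∎
  where open ≡-Reasoning

module _ {k : ℕ} .{{_ : NonZero k}} where

  toℕ-mod : ∀ x → toℕ (x mod k) ≡ x % k
  toℕ-mod x = toℕ-fromℕ< (m%n<n x k)

  toℕ-mod< : ∀ {x} → x < k → toℕ (x mod k) ≡ x
  toℕ-mod< {x} x<k = trans (toℕ-mod x) (m<n⇒m%n≡m x<k)

  cyclic : (Fin k → A) → ℕ → A
  cyclic f x = f (x mod k)

  module _ (f : Fin k → A) where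

    cyclic-cong : ∀ {x y} → x % k ≡ y % k → cyclic f x ≡ cyclic f y
    cyclic-cong {x} {y} eq = cong f (toℕ-injective (trans (toℕ-mod x) (trans eq (sym (toℕ-mod y)))))

    cyclic-+k : ∀ x → cyclic f (x + k) ≡ cyclic f x
    cyclic-+k x = cyclic-cong ([m+n]%n≡m%n x k)

    cyclic-+-mod : ∀ j x → cyclic f (j + x % k) ≡ cyclic f (j + x)
    cyclic-+-mod j x = cyclic-cong ([m+n%d]%d≡[m+n]%d j x k)

    cyclic-index : ∀ {i y} → toℕ i ≡ y → cyclic f y ≡ f i
    cyclic-index {i} refl = cong f (toℕ-injective (toℕ-mod< (toℕ<n i)))

  rotate : ℕ → Vec A k → Vec A k
  rotate r w = tabulate (λ j → cyclic (lookup w) (toℕ j + r))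

  rotate-inverse : ∀ {r : ℕ} (w : Vec A k) → r ≤ k → rotate (k ∸ r) (rotate r w) ≡ w
  rotate-inverse {r = r} w r≤k = trans (tabulate-cong rotated-back) (tabulate∘lookup w)
    where
    open ≡-Reasoning
    rotated-back : ∀ j → cyclic (lookup (rotate r w)) (toℕ j + (k ∸ r)) ≡ lookup w j
    rotated-back j = begin
      lookup (rotate r w) ((toℕ j + (k ∸ r)) mod k)         ≡⟨ lookup∘tabulate (λ i → cyclic (lookup w) (toℕ i + r)) _ ⟩
      cyclic (lookup w) (toℕ ((toℕ j + (k ∸ r)) mod k) + r) ≡⟨ cyclic-cong (lookup w) shifted-back ⟩
      cyclic (lookup w) (toℕ j + k)                         ≡⟨ cyclic-+k (lookup w) (toℕ j) ⟩
      cyclic (lookup w) (toℕ j)                             ≡⟨ cyclic-index (lookup w) refl ⟩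
      lookup w j                                            ∎
      where
      shifted-back : (toℕ ((toℕ j + (k ∸ r)) mod k) + r) % k ≡ (toℕ j + k) % k
      shifted-back = begin
        (toℕ ((toℕ j + (k ∸ r)) mod k) + r) % k ≡⟨ cong (λ t → (t + r) % k) (toℕ-mod (toℕ j + (k ∸ r))) ⟩
        ((toℕ j + (k ∸ r)) % k + r) % k        ≡⟨ [m%d+n]%d≡[m+n]%d (toℕ j + (k ∸ r)) r k ⟩
        (toℕ j + (k ∸ r) + r) % k              ≡⟨ cong (_% k) (+-assoc (toℕ j) (k ∸ r) r) ⟩
        (toℕ j + (k ∸ r + r)) % k              ≡⟨ cong (λ t → (toℕ j + t) % k) (m∸n+n≡m r≤k) ⟩
        (toℕ j + k) % k                        ∎

module _ {K : ℕ} .{{_ : NonZero K}} (f : Fin (suc K) → A) where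

  cyclic-inject₁ : ∀ {y} → y < K → cyclic (f ∘ inject₁) y ≡ cyclic f y
  cyclic-inject₁ y<K = sym (cyclic-index f (trans (toℕ-inject₁ _) (toℕ-mod< y<K)))

  cyclic-suc : ∀ {y} → y < K → cyclic (f ∘ fsuc) y ≡ cyclic f (suc y)
  cyclic-suc y<K = sym (cyclic-index f (cong suc (toℕ-mod< y<K)))

ConsecutiveMeet : ∀ {V} → (ℕ → Subset V) → Set
ConsecutiveMeet S = ∀ x → Nonempty (S x ∩ S (suc x))

ConsecutiveTriplesDisjoint : ∀ {V} → (ℕ → Subset V) → Set
ConsecutiveTriplesDisjoint S = ∀ x {a} → a ∈ₛ S x → a ∈ₛ S (suc x) → a ∈ₛ S (suc (suc x)) → ⊥

module _ {V k : ℕ} .{{_ : NonZero k}} {s : Fin k → Subset V} where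

  toℕ-mod-suc : ∀ {y} → suc y < k → toℕ (suc y mod k) ≡ suc (toℕ (y mod k))
  toℕ-mod-suc {y} 1+y<k = trans (toℕ-mod< 1+y<k) (cong suc (sym (toℕ-mod< (<-trans (n<1+n y) 1+y<k))))

  chain-meets : IsChain s → ∀ {y} → suc y < k → Nonempty (cyclic s y ∩ cyclic s (suc y))
  chain-meets (linked , _) {y} 1+y<k = ∣p∣≡1⇒Nonempty _ (linked (y mod k) (suc y mod k) (toℕ-mod-suc 1+y<k))

  chain-no-triple : IsChain s → ∀ {y a} → suc (suc y) < k →
                    a ∈ₛ cyclic s y → a ∈ₛ cyclic s (suc y) → a ∈ₛ cyclic s (suc (suc y)) → ⊥
  chain-no-triple (_ , links-disjoint) {y} {a} 2+y<k a∈₀ a∈₁ a∈₂ =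
    links-disjoint (y mod k) (suc y mod k) (suc y mod k) (suc (suc y) mod k)
      (toℕ-mod-suc 1+y<k) (toℕ-mod-suc 2+y<k) y≢1+y
      (a , x∈p∩q⁺ (x∈p∩q⁺ (a∈₀ , a∈₁) , x∈p∩q⁺ (a∈₁ , a∈₂)))
    where
    1+y<k : suc y < k
    1+y<k = <-trans (n<1+n (suc y)) 2+y<k
    y≢1+y : toℕ (y mod k) ≢ toℕ (suc y mod k)
    y≢1+y eq = 1+n≢n (sym (trans eq (toℕ-mod-suc 1+y<k)))

  disjointChain-apart : IsDisjointChain s → ∀ {y z a} → suc y < z → z < k →
                        a ∈ₛ cyclic s y → a ∈ₛ cyclic s z → ⊥
  disjointChain-apart (_ , apart , _) {y} {z} {a} 1+y<z z<k a∈y a∈z =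
    apart (y mod k) (z mod k) 1+y<z′ (a , x∈p∩q⁺ (a∈y , a∈z))
    where
    1+y<z′ : suc (toℕ (y mod k)) < toℕ (z mod k)
    1+y<z′ = subst₂ (λ i j → suc i < j) (sym (toℕ-mod< (<-trans (n<1+n y) (<-trans 1+y<z z<k))))
               (sym (toℕ-mod< z<k)) 1+y<z

module _ {V : ℕ} where

  wrap-triple-ending-at-start : ∀ {q} {s : Fin (3 + q) → Subset V} →
                                IsAlmostDisjointCycle (3 + q) s → ∀ {a} →
                                a ∈ₛ cyclic s (1 + q) → a ∈ₛ cyclic s (2 + q) → a ∈ₛ cyclic s 0 → ⊥
  wrap-triple-ending-at-start {zero} (chain , _) a∈₁ a∈₂ a∈₀ =
    chain-no-triple chain (s≤s (s≤s (s≤s z≤n))) a∈₀ a∈₁ a∈₂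
  wrap-triple-ending-at-start {suc q} {s} (_ , _ , initial , _) a∈₂₊q _ a∈₀ =
    disjointChain-apart initial (s≤s (s≤s z≤n)) (n<1+n (2 + q))
      (subst (_ ∈ₛ_) (sym (cyclic-inject₁ s (s≤s z≤n))) a∈₀)
      (subst (_ ∈ₛ_) (sym (cyclic-inject₁ s (n<1+n (2 + q)))) a∈₂₊q)

  wrap-triple-centred-at-start : ∀ {q} {s : Fin (3 + q) → Subset V} →
                                 IsAlmostDisjointCycle (3 + q) s → ∀ {a} →
                                 a ∈ₛ cyclic s (2 + q) → a ∈ₛ cyclic s 0 → a ∈ₛ cyclic s 1 → ⊥
  wrap-triple-centred-at-start {zero} (chain , _) a∈₂ a∈₀ a∈₁ =
    chain-no-triple chain (s≤s (s≤s (s≤s z≤n))) a∈₀ a∈₁ a∈₂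
  wrap-triple-centred-at-start {suc q} {s} (_ , _ , _ , final) a∈₃₊q _ a∈₁ =
    disjointChain-apart final (s≤s (s≤s z≤n)) (n<1+n (2 + q))
      (subst (_ ∈ₛ_) (sym (cyclic-suc s (s≤s z≤n))) a∈₁)
      (subst (_ ∈ₛ_) (sym (cyclic-suc s (n<1+n (2 + q)))) a∈₃₊q)

module _ {V q : ℕ} {s : Fin (3 + q) → Subset V} where

  private
    k : ℕ
    k = 3 + q

  wrap-meets : IsAlmostDisjointCycle k s → Nonempty (cyclic s (2 + q) ∩ cyclic s k)
  wrap-meets (_ , first∩last , _) =
    subst₂ (λ p r → Nonempty (p ∩ r)) (sym (cyclic-index s (toℕ-fromℕ (2 + q)))) (sym (cyclic-+k s 0))
      (subst Nonempty (∩-comm (s fzero) (s (fromℕ (2 + q)))) first∩last)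

  cycle-meets : IsAlmostDisjointCycle k s → ConsecutiveMeet (cyclic s)
  cycle-meets cycle@(chain , _) x =
    subst₂ (λ p r → Nonempty (p ∩ r)) (cyclic-+-mod s 0 x) (cyclic-+-mod s 1 x) (meets-below (m%n<n x k))
    where
    meets-below : ∀ {y} → y < k → Nonempty (cyclic s y ∩ cyclic s (suc y))
    meets-below y<k with m≤n⇒m<n∨m≡n y<k
    ... | inj₁ 1+y<k = chain-meets chain 1+y<k
    ... | inj₂ refl  = wrap-meets cycle

  cycle-no-triple : IsAlmostDisjointCycle k s → ConsecutiveTriplesDisjoint (cyclic s)
  cycle-no-triple cycle@(chain , _) x a∈₀ a∈₁ a∈₂ =
    no-triple-below (m%n<n x k) (reduce 0 a∈₀) (reduce 1 a∈₁) (reduce 2 a∈₂)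
    where
    reduce : ∀ j {a} → a ∈ₛ cyclic s (j + x) → a ∈ₛ cyclic s (j + x % k)
    reduce j = subst (_ ∈ₛ_) (sym (cyclic-+-mod s j x))
    no-triple-below : ∀ {y a} → y < k →
                      a ∈ₛ cyclic s y → a ∈ₛ cyclic s (suc y) → a ∈ₛ cyclic s (suc (suc y)) → ⊥
    no-triple-below y<k a∈₀ a∈₁ a∈₂ with m≤n⇒m<n∨m≡n y<k
    ... | inj₂ refl = wrap-triple-centred-at-start cycle a∈₀
                        (subst (_ ∈ₛ_) (cyclic-+k s 0) a∈₁) (subst (_ ∈ₛ_) (cyclic-+k s 1) a∈₂)
    ... | inj₁ 1+y<k with m≤n⇒m<n∨m≡n 1+y<k
    ...   | inj₂ refl  = wrap-triple-ending-at-start cycle a∈₀ a∈₁ (subst (_ ∈ₛ_) (cyclic-+k s 0) a∈₂)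
    ...   | inj₁ 2+y<k = chain-no-triple chain 2+y<k a∈₀ a∈₁ a∈₂

module Counting {V m : ℕ} (n d : ℕ) (E : Fin m → Subset V)
  (uniform : Uniform n E) (simple : Simple E) (degree≤d : ∀ u → degree E u ≤ d) where

  Meet : Fin m → Fin m → Set
  Meet e f = Nonempty (E e ∩ E f)

  length-elements≤n : ∀ e → length (elements (E e)) ≤ n
  length-elements≤n e = ≤-reflexive (trans (length-elements (E e)) (uniform e))

  edgesThrough : Fin V → List (Fin m)
  edgesThrough u = filter (λ e → u ∈? E e) (allFin m)

  ∈-edgesThrough : ∀ {u e} → u ∈ₛ E e → e ∈ edgesThrough u
  ∈-edgesThrough {u} {e} = ∈-filter⁺ (λ e → u ∈? E e) (∈-allFin e)

  common-edge-unique : ∀ {a b e f} → a ≢ b → a ∈ₛ E e → b ∈ₛ E e → a ∈ₛ E f → b ∈ₛ E f → f ≡ e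
  common-edge-unique {e = e} {f} a≢b a∈e b∈e a∈f b∈f with f ≟ e
  ... | yes f≡e = f≡e
  ... | no  f≢e = contradiction (simple f e f≢e)
                    (<⇒≱ (x≢y⇒1<∣p∣ (x∈p∩q⁺ (a∈f , a∈e)) (x∈p∩q⁺ (b∈f , b∈e)) a≢b))

  through? : ∀ a b → Decidable (λ e → a ∈ₛ E e × b ∈ₛ E e)
  through? a b e = a ∈? E e ×-dec b ∈? E e

  -- For a ≡ b this is an arbitrary edge through a; only the case a ≢ b is ever used.
  edgeThrough : Fin V → Fin V → List (Fin m)
  edgeThrough a b = take 1 (filter (through? a b) (allFin m))

  length-edgeThrough : ∀ a b → length (edgeThrough a b) ≤ 1
  length-edgeThrough a b = length-take-1 (filter (through? a b) (allFin m))

  ∈-edgeThrough : ∀ {a b e} → a ≢ b → a ∈ₛ E e → b ∈ₛ E e → e ∈ edgeThrough a b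
  ∈-edgeThrough {a} {b} {e} a≢b a∈e b∈e = ∈-take-1 (∈-filter⁺ (through? a b) (∈-allFin e) (a∈e , b∈e)) only-e
    where
    only-e : ∀ {f} → f ∈ filter (through? a b) (allFin m) → f ≡ e
    only-e f∈ = let a∈f , b∈f = proj₂ (∈-filter⁻ (through? a b) {xs = allFin m} f∈)
                in common-edge-unique a≢b a∈e b∈e a∈f b∈f

  neighbours : Fin m → List (Fin m)
  neighbours e = concatMap edgesThrough (elements (E e))

  length-neighbours : ∀ e → length (neighbours e) ≤ n * d
  length-neighbours e = length-concatMap≤ edgesThrough (elements (E e)) (length-elements≤n e) degree≤d

  ∈-neighbours : ∀ {e f} → Meet e f → f ∈ neighbours e
  ∈-neighbours {e} {f} (a , a∈e∩f) =
    let a∈e , a∈f = x∈p∩q⁻ (E e) (E f) a∈e∩f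
    in ∈-concatMap edgesThrough (∈-elements a∈e) (∈-edgesThrough a∈f)

  Closes : Fin m → Fin m → Fin m → Set
  Closes e₀ e f = ∃₂ λ a b → a ≢ b × (a ∈ₛ E e × a ∈ₛ E f) × (b ∈ₛ E f × b ∈ₛ E e₀)

  edgesJoining : Fin m → Fin V → List (Fin m)
  edgesJoining e₀ a = concatMap (edgeThrough a) (elements (E e₀))

  closers : Fin m → Fin m → List (Fin m)
  closers e₀ e = concatMap (edgesJoining e₀) (elements (E e))

  length-closers : ∀ e₀ e → length (closers e₀ e) ≤ n ^ 2
  length-closers e₀ e = length-concatMap≤ (edgesJoining e₀) (elements (E e)) (length-elements≤n e) λ a →
    length-concatMap≤ (edgeThrough a) (elements (E e₀)) (length-elements≤n e₀) (length-edgeThrough a)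

  ∈-closers : ∀ {e₀ e f} → Closes e₀ e f → f ∈ closers e₀ e
  ∈-closers {e₀} (a , b , a≢b , (a∈e , a∈f) , (b∈f , b∈e₀)) =
    ∈-concatMap (edgesJoining e₀) (∈-elements a∈e)
      (∈-concatMap (edgeThrough a) (∈-elements b∈e₀) (∈-edgeThrough a≢b a∈f b∈f))

  paths : (ℓ : ℕ) → Fin m → Fin m → List (Vec (Fin m) (suc ℓ))
  paths zero    e₀ e = map Vec.[_] (closers e₀ e)
  paths (suc ℓ) e₀ e = concatMap (prepend (paths ℓ e₀)) (neighbours e)

  length-paths : ∀ ℓ e₀ e → length (paths ℓ e₀ e) ≤ (n * d) ^ ℓ * n ^ 2
  length-paths zero e₀ e = begin
    length (map Vec.[_] (closers e₀ e)) ≡⟨ length-map Vec.[_] (closers e₀ e) ⟩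
    length (closers e₀ e)               ≤⟨ length-closers e₀ e ⟩
    n ^ 2                               ≡⟨ *-identityˡ (n ^ 2) ⟨
    1 * n ^ 2                           ∎
    where open ≤-Reasoning
  length-paths (suc ℓ) e₀ e = begin
    length (paths (suc ℓ) e₀ e) ≤⟨ length-concatMap≤ (prepend (paths ℓ e₀)) (neighbours e) (length-neighbours e)
                                     (length-prepend (paths ℓ e₀) (length-paths ℓ e₀)) ⟩
    n * d * ((n * d) ^ ℓ * n ^ 2) ≡⟨ *-assoc (n * d) ((n * d) ^ ℓ) (n ^ 2) ⟨
    (n * d) ^ suc ℓ * n ^ 2       ∎
    where open ≤-Reasoning

  ∈-paths : ∀ ℓ (g : ℕ → Fin m) {e₀} → ConsecutiveMeet (E ∘ g) → Closes e₀ (g ℓ) (g (suc ℓ)) →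
            tabulate (g ∘ suc ∘ toℕ) ∈ paths ℓ e₀ (g 0)
  ∈-paths zero    g meets closes = ∈-map⁺ Vec.[_] (∈-closers closes)
  ∈-paths (suc ℓ) g {e₀} meets closes = ∈-concatMap (prepend (paths ℓ e₀)) (∈-neighbours (meets 0))
    (∈-prepend (paths ℓ e₀) (∈-paths ℓ (g ∘ suc) (meets ∘ suc) closes))

  cycle-closes : ∀ (g : ℕ → Fin m) ℓ → ConsecutiveMeet (E ∘ g) → ConsecutiveTriplesDisjoint (E ∘ g) →
                 g (2 + ℓ) ≡ g 0 → Closes (g 0) (g ℓ) (g (suc ℓ))
  cycle-closes g ℓ meets triples-disjoint g₂₊ℓ≡g₀ =
    let a , a∈ℓ∩ℓ+1   = meets ℓ
        b , b∈ℓ+1∩ℓ+2 = meets (suc ℓ)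
        a∈ℓ , a∈ℓ+1   = x∈p∩q⁻ (E (g ℓ)) (E (g (suc ℓ))) a∈ℓ∩ℓ+1
        b∈ℓ+1 , b∈ℓ+2 = x∈p∩q⁻ (E (g (suc ℓ))) (E (g (2 + ℓ))) b∈ℓ+1∩ℓ+2
        a≢b : a ≢ b
        a≢b a≡b = triples-disjoint ℓ a∈ℓ a∈ℓ+1 (subst (_∈ₛ E (g (2 + ℓ))) (sym a≡b) b∈ℓ+2)
    in a , b , a≢b , (a∈ℓ , a∈ℓ+1) , (b∈ℓ+1 , subst (λ e → b ∈ₛ E e) g₂₊ℓ≡g₀ b∈ℓ+2)

  closedPaths : (ℓ : ℕ) → Fin m → List (Vec (Fin m) (suc ℓ))
  closedPaths ℓ e₀ = paths ℓ e₀ e₀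

  rooted : Fin V → (ℓ : ℕ) → List (Vec (Fin m) (2 + ℓ))
  rooted v ℓ = concatMap (prepend (closedPaths ℓ)) (edgesThrough v)

  length-rooted : ∀ v ℓ → length (rooted v ℓ) ≤ d * ((n * d) ^ ℓ * n ^ 2)
  length-rooted v ℓ = length-concatMap≤ (prepend (closedPaths ℓ)) (edgesThrough v) (degree≤d v)
    (length-prepend (closedPaths ℓ) (λ e₀ → length-paths ℓ e₀ e₀))

  ∈-rooted : ∀ {v} ℓ (g : ℕ → Fin m) → v ∈ₛ E (g 0) → ConsecutiveMeet (E ∘ g) →
             Closes (g 0) (g ℓ) (g (suc ℓ)) → tabulate (g ∘ toℕ) ∈ rooted v ℓ
  ∈-rooted ℓ g v∈g₀ meets closes =
    ∈-concatMap (prepend (closedPaths ℓ)) (∈-edgesThrough v∈g₀)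
      (∈-prepend (closedPaths ℓ) (∈-paths ℓ g meets closes))

  rotatedBack : Fin V → (ℓ : ℕ) → ℕ → List (Vec (Fin m) (2 + ℓ))
  rotatedBack v ℓ p = map (rotate (2 + ℓ ∸ p)) (rooted v ℓ)

  candidates : Fin V → (ℓ : ℕ) → List (Vec (Fin m) (2 + ℓ))
  candidates v ℓ = concatMap (rotatedBack v ℓ) (upTo (2 + ℓ))

  length-candidates : ∀ v ℓ → length (candidates v ℓ) ≤ (2 + ℓ) * (d * ((n * d) ^ ℓ * n ^ 2))
  length-candidates v ℓ =
    length-concatMap≤ (rotatedBack v ℓ) (upTo (2 + ℓ)) (≤-reflexive (length-upTo (2 + ℓ))) λ p →
    ≤-trans (≤-reflexive (length-map (rotate (2 + ℓ ∸ p)) (rooted v ℓ))) (length-rooted v ℓ)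

  ∈-candidates : ∀ {q v} {c : Vec (Fin m) (3 + q)} → AlmostDisjointCycle E (3 + q) c → BelongsTo E v c →
                 c ∈ candidates v (suc q)
  ∈-candidates {q} {v} {c} cycle (i , v∈cᵢ) =
    subst (_∈ candidates v (suc q)) (rotate-inverse c (<⇒≤ (toℕ<n i)))
      (∈-concatMap (rotatedBack v (suc q)) (∈-upTo⁺ (toℕ<n i)) (∈-map⁺ (rotate (3 + q ∸ p)) rotated∈rooted))
    where
    p : ℕ
    p = toℕ i
    g : ℕ → Fin m
    g x = cyclic (lookup c) (x + p)
    meets : ConsecutiveMeet (E ∘ g)
    meets x = cycle-meets cycle (x + p)
    triples : ConsecutiveTriplesDisjoint (E ∘ g)
    triples x = cycle-no-triple cycle (x + p)
    g-periodic : g (3 + q) ≡ g 0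
    g-periodic = trans (cong (cyclic (lookup c)) (+-comm (3 + q) p)) (cyclic-+k (lookup c) p)
    v∈g₀ : v ∈ₛ E (g 0)
    v∈g₀ = subst (λ e → v ∈ₛ E e) (sym (cyclic-index (lookup c) refl)) v∈cᵢ
    rotated∈rooted : rotate p c ∈ rooted v (suc q)
    rotated∈rooted = ∈-rooted (suc q) g v∈g₀ meets (cycle-closes g (suc q) meets triples g-periodic)

proposition11 : ∀ {V m : ℕ} (n d : ℕ) (E : Fin m → Subset V) →
    Injective _≡_ _≡_ E → Uniform n E → Simple E → MaxDegree E d →
    (v : Fin V) (k : ℕ) → 3 ≤ k →
    (cs : List (Vec (Fin m) k)) → Unique cs →
    All (λ c → AlmostDisjointCycle E k c × BelongsTo E v c) cs →
    length cs ≤ k * d * (k ∸ 1) * (n * d) ^ (k ∸ 2) * n ^ 2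
proposition11 n d E _ uniform simple (degree≤d , _) v (suc (suc (suc q))) (s≤s (s≤s (s≤s z≤n))) cs unique cycles =
  begin
    length cs                                   ≤⟨ unique⊆⇒length≤ unique cs⊆candidates ⟩
    length (candidates v (suc q))               ≤⟨ length-candidates v (suc q) ⟩
    k * (d * (P * n ^ 2))                       ≤⟨ m≤m*n (k * (d * (P * n ^ 2))) (2 + q) ⟩
    k * (d * (P * n ^ 2)) * (2 + q)             ≡⟨ reassociate k d (2 + q) P (n ^ 2) ⟩
    k * d * (k ∸ 1) * (n * d) ^ (k ∸ 2) * n ^ 2 ∎
  where
  open Counting n d E uniform simple degree≤d
  open ≤-Reasoning
  open +-*-Solver
  k P : ℕ
  k = 3 + q
  P = (n * d) ^ suc q
  cs⊆candidates : All (_∈ candidates v (suc q)) cs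
  cs⊆candidates = All.map (λ (cycle , v∈c) → ∈-candidates cycle v∈c) cycles
  reassociate : ∀ k d t P N → k * (d * (P * N)) * t ≡ k * d * t * P * N
  reassociate = solve 5 (λ k d t P N → k :* (d :* (P :* N)) :* t := k :* d :* t :* P :* N) refl
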